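{- Let $G$ be a connected graph. Then $\gamma_{cI}(G)=2$ if and only if $G\in\{K_{1,n},K_{2,n},K^*_{2,n}\}$ for some $n\geq 1$, where $K^*_{2,n}$ is the graph obtained from the complete bipartite graph $K_{2,n}$ by adding the edge joining the two vertices of its $2$-vertex part.
   Context: All graphs are finite and simple. A function $f:V(G)\to\{0,1,2\}$ is a covering Italian dominating function (CID function) of $G$ if (i) for every vertex $v$ with $f(v)=0$ we have $\sum_{u\in N(v)} f(u)\geq 2$, where $N(v)$ is the open neighborhood of $v$, and (ii) the set $\{v: f(v)=0\}$ is independent. $\gamma_{cI}(G)$ is the minimum of $\sum_v f(v)$ over all CID functions $f$ of $G$. -}

module Defs where

open import Data.Nat using (ℕ; zero; suc; _+_; _≤_; _<_)
open import Data.Nat.Properties using (_<?_)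
open import Data.Bool using (Bool; true; false; _∧_; _∨_; not; if_then_else_)
open import Data.Bool.Properties using (∨-comm; ∧-comm)
open import Data.Fin using (Fin; toℕ)
open import Data.Fin.Properties using (_≟_)
open import Data.Product using (Σ; _×_; _,_; ∃; ∃-syntax)
open import Function.Bundles using (_⤖_; Bijection)
open import Relation.Nullary.Decidable using (⌊_⌋; yes; no)
open import Relation.Binary.PropositionalEquality using (_≡_; refl; sym)

record Graph (n : ℕ) : Set where
  field
    Adj     : Fin n → Fin n → Bool
    Adj-sym : ∀ u v → Adj u v ≡ Adj v u
    Adj-irr : ∀ v → Adj v v ≡ false
open Graph public

ΣFin : (n : ℕ) → (Fin n → ℕ) → ℕ
ΣFin zero    f = 0
ΣFin (suc n) f = f Fin.zero + ΣFin n (λ i → f (Fin.suc i))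

nbrSum : ∀ {n} → Graph n → (Fin n → ℕ) → Fin n → ℕ
nbrSum {n} G f v = ΣFin n (λ u → if Adj G v u then f u else 0)

weight : ∀ {n} → (Fin n → ℕ) → ℕ
weight {n} f = ΣFin n f

IsCID : ∀ {n} → Graph n → (Fin n → ℕ) → Set
IsCID {n} G f =
  (∀ v → f v ≤ 2) ×
  (∀ v → f v ≡ 0 → 2 ≤ nbrSum G f v) ×
  (∀ u v → f u ≡ 0 → f v ≡ 0 → Adj G u v ≡ false)

γcI≡ : ∀ {n} → Graph n → ℕ → Set
γcI≡ {n} G k =
  (Σ (Fin n → ℕ) λ f → IsCID G f × weight f ≡ k) ×
  (∀ (f : Fin n → ℕ) → IsCID G f → k ≤ weight f)

data Reach {n : ℕ} (G : Graph n) : Fin n → Fin n → Set where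
  here : ∀ {v} → Reach G v v
  step : ∀ {u w v} → Adj G u w ≡ true → Reach G w v → Reach G u v

Connected : ∀ {n} → Graph n → Set
Connected {n} G = ∀ (u v : Fin n) → Reach G u v

_≅_ : ∀ {n m} → Graph n → Graph m → Set
_≅_ {n} {m} G H =
  Σ (Fin n ⤖ Fin m) λ φ → ∀ u v → Adj G u v ≡ Adj H (Bijection.to φ u) (Bijection.to φ v)

eqb : ∀ {n} → Fin n → Fin n → Bool
eqb u v = ⌊ u ≟ v ⌋

eqb-sym : ∀ {n} (u v : Fin n) → eqb u v ≡ eqb v u
eqb-sym u v with u ≟ v | v ≟ u
... | yes _ | yes _ = refl
... | no _  | no _  = refl
... | yes p | no q  with q (sym p)
... | ()
eqb-sym u v | no q | yes p with q (sym p)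
... | ()

eqb-refl : ∀ {n} (v : Fin n) → eqb v v ≡ true
eqb-refl v with v ≟ v
... | yes _ = refl
... | no q with q refl
... | ()

differ : Bool → Bool → Bool
differ true  b = not b
differ false b = b

differ-comm : ∀ a b → differ a b ≡ differ b a
differ-comm true true = refl
differ-comm true false = refl
differ-comm false true = refl
differ-comm false false = refl

differ-self : ∀ a → differ a a ≡ false
differ-self true = refl
differ-self false = refl

-- K_{1,n}: vertices Fin (1 + n); the centre is vertex 0, the leaves are the rest.
isCentre : ∀ {m} → Fin m → Bool
isCentre v = ⌊ toℕ v <? 1 ⌋

K1n : (n : ℕ) → Graph (suc n)
K1n n = record
  { Adj = λ u v → differ (isCentre u) (isCentre v)
  ; Adj-sym = λ u v → differ-comm (isCentre u) (isCentre v)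
  ; Adj-irr = λ v → differ-self (isCentre v) }

-- K_{2,n}: vertices Fin (2 + n); part A = {0,1}, part B = the remaining n vertices.
inA : ∀ {m} → Fin m → Bool
inA v = ⌊ toℕ v <? 2 ⌋

K2n : (n : ℕ) → Graph (2 + n)
K2n n = record
  { Adj = λ u v → differ (inA u) (inA v)
  ; Adj-sym = λ u v → differ-comm (inA u) (inA v)
  ; Adj-irr = λ v → differ-self (inA v) }

-- K*_{2,n}: K_{2,n} plus the edge joining the two vertices of part A.
-- u ~ v iff u ≠ v and at least one of u, v lies in A.
K*2n : (n : ℕ) → Graph (2 + n)
K*2n n = record
  { Adj = λ u v → (inA u ∨ inA v) ∧ not (eqb u v)
  ; Adj-sym = λ u v → sym' u v
  ; Adj-irr = λ v → irr v }
  where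
  sym' : ∀ (u v : Fin (2 + n)) → ((inA u ∨ inA v) ∧ not (eqb u v)) ≡ ((inA v ∨ inA u) ∧ not (eqb v u))
  sym' u v rewrite ∨-comm (inA u) (inA v) | eqb-sym u v = refl
  irr : ∀ (v : Fin (2 + n)) → ((inA v ∨ inA v) ∧ not (eqb v v)) ≡ false
  irr v rewrite eqb-refl v = ∧-comm (inA v ∨ inA v) false

{-# OPTIONS --safe #-}
-- If f is a CID function of weight 2, every vertex v outside the support of f has
-- 2 ≤ f(N(v)) ≤ w(f) = 2, so v is adjacent to the whole support, and the vertices outside the
-- support are pairwise non-adjacent. Hence G is the join of its support (one vertex of weight 2,
-- or two vertices of weight 1) with an edgeless graph: a star, or K_{2,n} or K*_{2,n} according
-- as the two support vertices are adjacent. Conversely, on such a join these functions are CID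
-- functions of weight 2, and no graph with an edge has a CID function of weight below 2.
module Submission where

open import Defs
open import Data.Nat using (ℕ; _≤_)
open import Data.Product using (_×_; ∃-syntax)
open import Data.Sum using (_⊎_)
open import Function.Bundles using (_⇔_)

open import Data.Bool using (Bool; true; false; _∧_; _∨_; not; if_then_else_)
open import Data.Bool.Properties using (if-eta)
open import Data.Empty using (⊥-elim)
open import Data.Fin using (Fin; zero; suc)
open import Data.Fin.Patterns using (0F; 1F; 2F)
open import Data.Fin.Permutation
  using (Permutation; Permutation′; _⟨$⟩ʳ_; _⟨$⟩ˡ_; inverseˡ; inverseʳ; transpose; _∘ₚ_)
  renaming (id to idₚ)
import Data.Fin.Permutation.Components as PC
open import Data.Fin.Properties using (_≟_) renaming (suc-injective to Fin-suc-injective)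
open import Data.Nat using (zero; suc; _+_; _<_; _<ᵇ_; z≤n; s≤s; z<s)
open import Data.Nat.Properties
  using (≤-refl; ≤-trans; ≤-reflexive; <⇒≱; +-mono-≤; +-mono-<-≤; +-mono-≤-<; +-identityʳ; +-comm;
         m≤m+n; m≤n+m; m+n≡0⇒m≡0; m+n≡0⇒n≡0; suc-injective; +-commutativeSemigroup)
open import Algebra.Properties.CommutativeSemigroup +-commutativeSemigroup using (interchange)
open import Data.Product using (Σ; _,_)
open import Data.Sum using (inj₁; inj₂)
open import Function.Base using (_∘_)
open import Function.Bundles using (mk⇔)
open import Function.Properties.Bijection using (⤖⇒↔)
open import Function.Properties.Inverse using (↔⇒⤖)
open import Relation.Binary.PropositionalEquality using (_≡_; _≢_; refl; sym; trans; cong; cong₂; subst)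
open import Relation.Nullary.Decidable using (yes; no; dec-true; dec-false)

ΣFin-cong : ∀ n {f g : Fin n → ℕ} → (∀ x → f x ≡ g x) → ΣFin n f ≡ ΣFin n g
ΣFin-cong zero    f≗g = refl
ΣFin-cong (suc n) f≗g = cong₂ _+_ (f≗g zero) (ΣFin-cong n (f≗g ∘ suc))

ΣFin-mono : ∀ n {f g : Fin n → ℕ} → (∀ x → f x ≤ g x) → ΣFin n f ≤ ΣFin n g
ΣFin-mono zero    f≤g = z≤n
ΣFin-mono (suc n) f≤g = +-mono-≤ (f≤g zero) (ΣFin-mono n (f≤g ∘ suc))

ΣFin-mono-< : ∀ n {f g : Fin n → ℕ} → (∀ x → f x ≤ g x) →
  ∀ a → f a < g a → ΣFin n f < ΣFin n g
ΣFin-mono-< (suc n) f≤g zero    fa<ga = +-mono-<-≤ fa<ga (ΣFin-mono n (f≤g ∘ suc))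
ΣFin-mono-< (suc n) f≤g (suc a) fa<ga = +-mono-≤-< (f≤g zero) (ΣFin-mono-< n (f≤g ∘ suc) a fa<ga)

ΣFin-+ : ∀ n (f g : Fin n → ℕ) → ΣFin n (λ x → f x + g x) ≡ ΣFin n f + ΣFin n g
ΣFin-+ zero    f g = refl
ΣFin-+ (suc n) f g = trans (cong (f zero + g zero +_) (ΣFin-+ n (f ∘ suc) (g ∘ suc)))
                           (interchange (f zero) (g zero) (ΣFin n (f ∘ suc)) (ΣFin n (g ∘ suc)))

ΣFin-zero : ∀ n → ΣFin n (λ _ → 0) ≡ 0
ΣFin-zero zero    = refl
ΣFin-zero (suc n) = ΣFin-zero n

≤-ΣFin : ∀ n (f : Fin n → ℕ) a → f a ≤ ΣFin n f
≤-ΣFin (suc n) f zero    = m≤m+n (f zero) _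
≤-ΣFin (suc n) f (suc a) = ≤-trans (≤-ΣFin n (f ∘ suc) a) (m≤n+m _ (f zero))

+-≤-ΣFin : ∀ n (f : Fin n → ℕ) {a b} → a ≢ b → f a + f b ≤ ΣFin n f
+-≤-ΣFin (suc n) f {zero}  {zero}  a≢b = ⊥-elim (a≢b refl)
+-≤-ΣFin (suc n) f {zero}  {suc b} a≢b = +-mono-≤ ≤-refl (≤-ΣFin n (f ∘ suc) b)
+-≤-ΣFin (suc n) f {suc a} {zero}  a≢b =
  ≤-trans (≤-reflexive (+-comm (f (suc a)) (f zero))) (+-mono-≤ ≤-refl (≤-ΣFin n (f ∘ suc) a))
+-≤-ΣFin (suc n) f {suc a} {suc b} a≢b =
  ≤-trans (+-≤-ΣFin n (f ∘ suc) (a≢b ∘ cong suc)) (m≤n+m _ (f zero))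

ΣFin≡0⇒≡0 : ∀ n (f : Fin n → ℕ) → ΣFin n f ≡ 0 → ∀ x → f x ≡ 0
ΣFin≡0⇒≡0 (suc n) f Σf≡0 zero    = m+n≡0⇒m≡0 (f zero) Σf≡0
ΣFin≡0⇒≡0 (suc n) f Σf≡0 (suc x) = ΣFin≡0⇒≡0 n (f ∘ suc) (m+n≡0⇒n≡0 (f zero) Σf≡0) x

eqb-suc : ∀ {n} (x a : Fin n) → eqb (suc x) (suc a) ≡ eqb x a
eqb-suc x a with x ≟ a
... | yes _ = refl
... | no _  = refl

pointMass : ∀ {n} → Fin n → ℕ → Fin n → ℕ
pointMass a k x = if eqb x a then k else 0

pointMass-suc : ∀ {n} (a : Fin n) k x → pointMass (suc a) k (suc x) ≡ pointMass a k x
pointMass-suc a k x = cong (if_then k else 0) (eqb-suc x a)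

ΣFin-pointMass : ∀ n (a : Fin n) k → ΣFin n (pointMass a k) ≡ k
ΣFin-pointMass (suc n) zero    k = trans (cong (k +_) (ΣFin-zero n)) (+-identityʳ k)
ΣFin-pointMass (suc n) (suc a) k = trans (ΣFin-cong n (pointMass-suc a k)) (ΣFin-pointMass n a k)

ΣFin≡1⇒pointMass : ∀ n (f : Fin n → ℕ) → ΣFin n f ≡ 1 → ∃[ a ] (∀ x → f x ≡ pointMass a 1 x)
ΣFin≡1⇒pointMass (suc n) f Σf≡1 with f zero in f0
... | 0 with ΣFin≡1⇒pointMass n (f ∘ suc) Σf≡1
...   | a , f≗ = suc a , λ { zero → f0 ; (suc x) → trans (f≗ x) (sym (pointMass-suc a 1 x)) }
ΣFin≡1⇒pointMass (suc n) f Σf≡1 | 1 =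
  zero , λ { zero → f0 ; (suc x) → ΣFin≡0⇒≡0 n (f ∘ suc) (suc-injective Σf≡1) x }

data WeightTwo {n} (f : Fin n → ℕ) : Set where
  single : ∀ c → (∀ x → f x ≡ pointMass c 2 x) → WeightTwo f
  double : ∀ a b → a ≢ b → (∀ x → f x ≡ pointMass a 1 x + pointMass b 1 x) → WeightTwo f

ΣFin≡2⇒WeightTwo : ∀ n (f : Fin n → ℕ) → ΣFin n f ≡ 2 → WeightTwo f
ΣFin≡2⇒WeightTwo (suc n) f Σf≡2 with f zero in f0
... | 0 with ΣFin≡2⇒WeightTwo n (f ∘ suc) Σf≡2
...   | single c f≗ =
        single (suc c) λ { zero → f0 ; (suc x) → trans (f≗ x) (sym (pointMass-suc c 2 x)) }
...   | double a b a≢b f≗ =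
        double (suc a) (suc b) (a≢b ∘ Fin-suc-injective) λ
          { zero    → f0
          ; (suc x) → trans (f≗ x) (sym (cong₂ _+_ (pointMass-suc a 1 x) (pointMass-suc b 1 x)))
          }
ΣFin≡2⇒WeightTwo (suc n) f Σf≡2 | 1 with ΣFin≡1⇒pointMass n (f ∘ suc) (suc-injective Σf≡2)
...   | b , f≗ =
        double zero (suc b) (λ ()) λ { zero → f0 ; (suc x) → trans (f≗ x) (sym (pointMass-suc b 1 x)) }
ΣFin≡2⇒WeightTwo (suc n) f Σf≡2 | 2 =
  single zero λ { zero → f0 ; (suc x) → ΣFin≡0⇒≡0 n (f ∘ suc) (suc-injective (suc-injective Σf≡2)) x }

support : ∀ {n} → (Fin n → ℕ) → Fin n → Bool
support f x = 0 <ᵇ f x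

support-cong : ∀ {n} {f g : Fin n → ℕ} → (∀ x → f x ≡ g x) → ∀ x → support f x ≡ support g x
support-cong f≗g x = cong (0 <ᵇ_) (f≗g x)

support-pointMass : ∀ {n} (c : Fin n) k x → support (pointMass c (suc k)) x ≡ eqb x c
support-pointMass c k x with eqb x c
... | true  = refl
... | false = refl

support-pointMass₂ : ∀ {n} (a b : Fin n) x →
  support (λ y → pointMass a 1 y + pointMass b 1 y) x ≡ (eqb x a ∨ eqb x b)
support-pointMass₂ a b x with eqb x a | eqb x b
... | true  | _     = refl
... | false | true  = refl
... | false | false = refl

0<ᵇ⇒0< : ∀ m → (0 <ᵇ m) ≡ true → 0 < m
0<ᵇ⇒0< (suc m) _ = z<s

0≮ᵇ⇒≡0 : ∀ m → (0 <ᵇ m) ≡ false → m ≡ 0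
0≮ᵇ⇒≡0 zero _ = refl

if-then-0-≤ : ∀ b k → (if b then k else 0) ≤ k
if-then-0-≤ true  k = ≤-refl
if-then-0-≤ false k = z≤n

module _ {n} (G : Graph n) (f : Fin n → ℕ) (v : Fin n) where

  nbrSum≤weight : nbrSum G f v ≤ weight f
  nbrSum≤weight = ΣFin-mono n (λ u → if-then-0-≤ (Adj G v u) (f u))

  weight≤nbrSum⇒adjacent-to-support :
    weight f ≤ nbrSum G f v → ∀ u → support f u ≡ true → Adj G v u ≡ true
  weight≤nbrSum⇒adjacent-to-support w≤nbr u u∈ with Adj G v u in vu
  ... | true  = refl
  ... | false = ⊥-elim (<⇒≱ nbr<w w≤nbr)
    where
    summand<fu : (if Adj G v u then f u else 0) < f u
    summand<fu rewrite vu = 0<ᵇ⇒0< (f u) u∈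
    nbr<w : nbrSum G f v < weight f
    nbr<w = ΣFin-mono-< n (λ w → if-then-0-≤ (Adj G v w) (f w)) u summand<fu

  adjacent-to-support⇒nbrSum≡weight :
    (∀ u → support f u ≡ true → Adj G v u ≡ true) → nbrSum G f v ≡ weight f
  adjacent-to-support⇒nbrSum≡weight adj = ΣFin-cong n summand≡fu
    where
    summand≡fu : ∀ u → (if Adj G v u then f u else 0) ≡ f u
    summand≡fu u with f u in fu
    ... | zero  = if-eta (Adj G v u)
    ... | suc k rewrite adj u (cong (0 <ᵇ_) fu) = refl

record IsIndependentJoin {n} (G : Graph n) (S : Fin n → Bool) : Set where
  field
    join        : ∀ x s → S x ≡ false → S s ≡ true → Adj G x s ≡ true
    independent : ∀ x y → S x ≡ false → S y ≡ false → Adj G x y ≡ false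
open IsIndependentJoin

independentJoin-resp : ∀ {n} {G : Graph n} {S T : Fin n → Bool} →
  (∀ x → S x ≡ T x) → IsIndependentJoin G S → IsIndependentJoin G T
independentJoin-resp S≗T J = record
  { join        = λ x s x∉ s∈ → join J x s (trans (S≗T x) x∉) (trans (S≗T s) s∈)
  ; independent = λ x y x∉ y∉ → independent J x y (trans (S≗T x) x∉) (trans (S≗T y) y∉)
  }

module _ {n} (G : Graph n) (f : Fin n → ℕ) where

  cid⇒independentJoin : IsCID G f → weight f ≤ 2 → IsIndependentJoin G (support f)
  cid⇒independentJoin (_ , covered , zeros-independent) w≤2 = record
    { join        = λ x s x∉ → weight≤nbrSum⇒adjacent-to-support G f x
                                 (≤-trans w≤2 (covered x (0≮ᵇ⇒≡0 (f x) x∉))) s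
    ; independent = λ x y x∉ y∉ → zeros-independent x y (0≮ᵇ⇒≡0 (f x) x∉) (0≮ᵇ⇒≡0 (f y) y∉)
    }

  independentJoin⇒cid :
    IsIndependentJoin G (support f) → (∀ v → f v ≤ 2) → 2 ≤ weight f → IsCID G f
  independentJoin⇒cid J f≤2 2≤w =
      f≤2
    , (λ v fv≡0 → ≤-trans 2≤w (≤-reflexive (sym (adjacent-to-support⇒nbrSum≡weight G f v
                    (λ u → join J v u (cong (0 <ᵇ_) fv≡0))))))
    , λ u v fu≡0 fv≡0 → independent J u v (cong (0 <ᵇ_) fu≡0) (cong (0 <ᵇ_) fv≡0)

  weight≥2-of-edge : ∀ {u v} → Adj G u v ≡ true → IsCID G f → 2 ≤ weight f
  weight≥2-of-edge {u} {v} uv (_ , covered , _) with f u in fu | f v in fv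
  ... | 0           | _     = ≤-trans (covered u fu) (nbrSum≤weight G f u)
  ... | _           | 0     = ≤-trans (covered v fv) (nbrSum≤weight G f v)
  ... | suc (suc _) | _     = ≤-trans (s≤s (s≤s z≤n)) (subst (_≤ weight f) fu (≤-ΣFin n f u))
  ... | 1           | suc _ =
    ≤-trans (s≤s (s≤s z≤n)) (subst (_≤ weight f) (cong₂ _+_ fu fv) (+-≤-ΣFin n f u≢v))
    where
    u≢v : u ≢ v
    u≢v refl with trans (sym uv) (Adj-irr G u)
    ... | ()

eqb-≢ : ∀ {n} {x y : Fin n} → x ≢ y → eqb x y ≡ false
eqb-≢ {x = x} {y} x≢y with x ≟ y
... | yes x≡y = ⊥-elim (x≢y x≡y)
... | no _    = refl

eqb≡true⇒≡ : ∀ {n} {x y : Fin n} → eqb x y ≡ true → x ≡ y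
eqb≡true⇒≡ {x = x} {y} _ with x ≟ y
eqb≡true⇒≡ _  | yes x≡y = x≡y
eqb≡true⇒≡ () | no _

eqb-∨≡true⇒≡ : ∀ {n} {x a b : Fin n} → (eqb x a ∨ eqb x b) ≡ true → x ≡ a ⊎ x ≡ b
eqb-∨≡true⇒≡ {x = x} {a} {b} x∈ with eqb x a in xa | eqb x b in xb
... | true  | _    = inj₁ (eqb≡true⇒≡ xa)
... | false | true = inj₂ (eqb≡true⇒≡ xb)

eqb-⟨$⟩ʳ : ∀ {m n} (π : Permutation m n) u y → eqb (π ⟨$⟩ʳ u) y ≡ eqb u (π ⟨$⟩ˡ y)
eqb-⟨$⟩ʳ π u y with u ≟ π ⟨$⟩ˡ y
... | yes refl = trans (cong (λ z → eqb z y) (inverseʳ π)) (eqb-refl y)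
... | no u≢π⁻¹y = eqb-≢ (λ πu≡y → u≢π⁻¹y (trans (sym (inverseˡ π)) (cong (π ⟨$⟩ˡ_) πu≡y)))

⟨$⟩ʳ-injective : ∀ {m n} (π : Permutation m n) {x y} → π ⟨$⟩ʳ x ≡ π ⟨$⟩ʳ y → x ≡ y
⟨$⟩ʳ-injective π πx≡πy = trans (sym (inverseˡ π)) (trans (cong (π ⟨$⟩ˡ_) πx≡πy) (inverseˡ π))

transpose-at-left : ∀ {n} (i j : Fin n) → PC.transpose i j i ≡ j
transpose-at-left i j rewrite dec-true (i ≟ i) refl = refl

transpose-elsewhere : ∀ {n} {i j k : Fin n} → k ≢ i → k ≢ j → PC.transpose i j k ≡ k
transpose-elsewhere {i = i} {j} {k} k≢i k≢j
  rewrite dec-false (k ≟ i) k≢i | dec-false (k ≟ j) k≢j = refl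

permutation-sending-to-0 : ∀ {n} (c : Fin (suc n)) →
  Σ (Permutation′ (suc n)) λ π → π ⟨$⟩ˡ 0F ≡ c
permutation-sending-to-0 c = transpose c 0F , transpose-at-left 0F c

permutation-sending-to-01 : ∀ {n} {a b : Fin (suc (suc n))} → a ≢ b →
  Σ (Permutation′ (suc (suc n))) λ π → π ⟨$⟩ˡ 0F ≡ a × π ⟨$⟩ˡ 1F ≡ b
permutation-sending-to-01 {a = a} {b} a≢b = τ ∘ₚ σ , π⁻¹0≡a , inverseˡ τ {b}
  where
  τ = transpose a 0F
  σ = transpose (τ ⟨$⟩ʳ b) 1F
  0≢τb : 0F ≢ τ ⟨$⟩ʳ b
  0≢τb 0≡τb = a≢b (⟨$⟩ʳ-injective τ (trans (transpose-at-left a 0F) 0≡τb))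
  π⁻¹0≡a : τ ⟨$⟩ˡ (σ ⟨$⟩ˡ 0F) ≡ a
  π⁻¹0≡a = trans (cong (τ ⟨$⟩ˡ_) (transpose-elsewhere {i = 1F} (λ ()) 0≢τb))
                 (transpose-at-left 0F a)

isCentre≡eqb0 : ∀ {n} (y : Fin (suc n)) → isCentre y ≡ eqb y 0F
isCentre≡eqb0 zero    = refl
isCentre≡eqb0 (suc y) = refl

inA≡eqb01 : ∀ {n} (y : Fin (suc (suc n))) → inA y ≡ (eqb y 0F ∨ eqb y 1F)
inA≡eqb01 zero          = refl
inA≡eqb01 (suc zero)    = refl
inA≡eqb01 (suc (suc y)) = refl

separated-by : ∀ {A : Set} (S : A → Bool) {x s} → S x ≡ false → S s ≡ true → x ≢ s
separated-by S x∉ s∈ refl with trans (sym x∉) s∈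
... | ()

K1n-isIndependentJoin : ∀ n → IsIndependentJoin (K1n n) isCentre
K1n-isIndependentJoin n = record
  { join        = λ { x s x∉ s∈ → cong₂ differ x∉ s∈ }
  ; independent = λ { x y x∉ y∉ → cong₂ differ x∉ y∉ }
  }

K2n-isIndependentJoin : ∀ n → IsIndependentJoin (K2n n) inA
K2n-isIndependentJoin n = record
  { join        = λ { x s x∉ s∈ → cong₂ differ x∉ s∈ }
  ; independent = λ { x y x∉ y∉ → cong₂ differ x∉ y∉ }
  }

K*2n-isIndependentJoin : ∀ n → IsIndependentJoin (K*2n n) inA
K*2n-isIndependentJoin n = record
  { join        = λ x s x∉ s∈ → trans (cong₂ (λ p q → (p ∨ q) ∧ not (eqb x s)) x∉ s∈)
                                      (cong not (eqb-≢ (separated-by inA x∉ s∈)))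
  ; independent = λ x y x∉ y∉ → cong₂ (λ p q → (p ∨ q) ∧ not (eqb x y)) x∉ y∉
  }

≅-of-independentJoins : ∀ {N M} {G : Graph N} {H : Graph M} {S T} (π : Permutation N M) →
  IsIndependentJoin G S → IsIndependentJoin H T → (∀ u → T (π ⟨$⟩ʳ u) ≡ S u) →
  ∀ a b → (∀ u → S u ≡ true → u ≡ a ⊎ u ≡ b) →
  Adj G a b ≡ Adj H (π ⟨$⟩ʳ a) (π ⟨$⟩ʳ b) → G ≅ H
≅-of-independentJoins {G = G} {H} {S} {T} π JG JH T∘π≗S a b S⊆ab Gab≡Hab = ↔⇒⤖ π , adjacency
  where
  to = π ⟨$⟩ʳ_
  irreflexive : ∀ u → Adj G u u ≡ Adj H (to u) (to u)
  irreflexive u = trans (Adj-irr G u) (sym (Adj-irr H (to u)))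
  inside : ∀ {u v} → u ≡ a ⊎ u ≡ b → v ≡ a ⊎ v ≡ b → Adj G u v ≡ Adj H (to u) (to v)
  inside (inj₁ refl) (inj₁ refl) = irreflexive a
  inside (inj₁ refl) (inj₂ refl) = Gab≡Hab
  inside (inj₂ refl) (inj₁ refl) = trans (Adj-sym G b a) (trans Gab≡Hab (Adj-sym H (to a) (to b)))
  inside (inj₂ refl) (inj₂ refl) = irreflexive b
  across : ∀ {x s} → S x ≡ false → S s ≡ true → Adj G x s ≡ Adj H (to x) (to s)
  across {x} {s} x∉ s∈ =
    trans (join JG x s x∉ s∈)
          (sym (join JH (to x) (to s) (trans (T∘π≗S x) x∉) (trans (T∘π≗S s) s∈)))
  outside : ∀ {x y} → S x ≡ false → S y ≡ false → Adj G x y ≡ Adj H (to x) (to y)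
  outside {x} {y} x∉ y∉ =
    trans (independent JG x y x∉ y∉)
          (sym (independent JH (to x) (to y) (trans (T∘π≗S x) x∉) (trans (T∘π≗S y) y∉)))
  adjacency : ∀ u v → Adj G u v ≡ Adj H (to u) (to v)
  adjacency u v with S u in su | S v in sv
  ... | true  | true  = inside (S⊆ab u su) (S⊆ab v sv)
  ... | false | true  = across su sv
  ... | true  | false = trans (Adj-sym G u v) (trans (across sv su) (Adj-sym H (to v) (to u)))
  ... | false | false = outside su sv

≅⇒permutation : ∀ {N M} {G : Graph N} {H : Graph M} → G ≅ H → Permutation N M
≅⇒permutation (φ , _) = ⤖⇒↔ φ

independentJoin-pullback : ∀ {N M} (G : Graph N) (H : Graph M) {T} (G≅H : G ≅ H) →
  IsIndependentJoin H T → IsIndependentJoin G (λ u → T (≅⇒permutation {G = G} {H} G≅H ⟨$⟩ʳ u))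
independentJoin-pullback G H (φ , adj) JH = record
  { join        = λ x s x∉ s∈ → trans (adj x s) (join JH _ _ x∉ s∈)
  ; independent = λ x y x∉ y∉ → trans (adj x y) (independent JH _ _ x∉ y∉)
  }

≅-reflects-adjacency : ∀ {N M} (G : Graph N) (H : Graph M) (G≅H : G ≅ H) x y →
  let π = ≅⇒permutation {G = G} {H} G≅H in Adj G (π ⟨$⟩ˡ x) (π ⟨$⟩ˡ y) ≡ Adj H x y
≅-reflects-adjacency G H (φ , adj) x y = trans (adj _ _) (cong₂ (Adj H) (inverseʳ π) (inverseʳ π))
  where π = ⤖⇒↔ φ

γcI≡2-of-independentJoin : ∀ {n} (G : Graph n) (f : Fin n → ℕ) → IsIndependentJoin G (support f) →
  (∀ v → f v ≤ 2) → weight f ≡ 2 → ∀ {u v} → Adj G u v ≡ true → γcI≡ G 2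
γcI≡2-of-independentJoin G f J f≤2 w≡2 uv =
  (f , independentJoin⇒cid G f J f≤2 (≤-reflexive (sym w≡2)) , w≡2) , λ g → weight≥2-of-edge G g uv

γcI≡2-of-≅K1n : ∀ {N} m (G : Graph N) → G ≅ K1n (suc m) → γcI≡ G 2
γcI≡2-of-≅K1n {N} m G G≅K =
  γcI≡2-of-independentJoin G f J (λ v → if-then-0-≤ (eqb v c) 2) (ΣFin-pointMass N c 2)
    (≅-reflects-adjacency G (K1n (suc m)) G≅K 0F 1F)
  where
  π = ≅⇒permutation {G = G} {K1n (suc m)} G≅K
  c = π ⟨$⟩ˡ 0F
  f = pointMass c 2
  centre≗support : ∀ u → isCentre (π ⟨$⟩ʳ u) ≡ support f u
  centre≗support u =
    trans (isCentre≡eqb0 (π ⟨$⟩ʳ u)) (trans (eqb-⟨$⟩ʳ π u 0F) (sym (support-pointMass c 1 u)))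
  J = independentJoin-resp centre≗support
        (independentJoin-pullback G (K1n (suc m)) G≅K (K1n-isIndependentJoin (suc m)))

γcI≡2-of-≅-inA-join : ∀ {N} m (G : Graph N) (H : Graph (suc (suc (suc m)))) →
  IsIndependentJoin H inA → Adj H 0F 2F ≡ true → G ≅ H → γcI≡ G 2
γcI≡2-of-≅-inA-join {N} m G H JH H02 G≅H =
  γcI≡2-of-independentJoin G f J
    (λ v → +-mono-≤ (if-then-0-≤ (eqb v a) 1) (if-then-0-≤ (eqb v b) 1))
    (trans (ΣFin-+ N (pointMass a 1) (pointMass b 1))
           (cong₂ _+_ (ΣFin-pointMass N a 1) (ΣFin-pointMass N b 1)))
    (trans (≅-reflects-adjacency G H G≅H 0F 2F) H02)
  where
  π = ≅⇒permutation {G = G} {H} G≅H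
  a = π ⟨$⟩ˡ 0F
  b = π ⟨$⟩ˡ 1F
  f = λ x → pointMass a 1 x + pointMass b 1 x
  inA≗support : ∀ u → inA (π ⟨$⟩ʳ u) ≡ support f u
  inA≗support u = trans (inA≡eqb01 (π ⟨$⟩ʳ u))
    (trans (cong₂ _∨_ (eqb-⟨$⟩ʳ π u 0F) (eqb-⟨$⟩ʳ π u 1F)) (sym (support-pointMass₂ a b u)))
  J = independentJoin-resp inA≗support (independentJoin-pullback G H G≅H JH)

≅K1n-of-join-over-point : ∀ {n} (G : Graph (suc n)) c →
  IsIndependentJoin G (λ x → eqb x c) → G ≅ K1n n
≅K1n-of-join-over-point {n} G c J with permutation-sending-to-0 c
... | π , π⁻¹0≡c =
  ≅-of-independentJoins π J (K1n-isIndependentJoin n) centre≗ c c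
    (λ u u∈ → inj₁ (eqb≡true⇒≡ u∈)) (trans (Adj-irr G c) (sym (Adj-irr (K1n n) (π ⟨$⟩ʳ c))))
  where
  centre≗ : ∀ u → isCentre (π ⟨$⟩ʳ u) ≡ eqb u c
  centre≗ u = trans (isCentre≡eqb0 (π ⟨$⟩ʳ u)) (trans (eqb-⟨$⟩ʳ π u 0F) (cong (eqb u) π⁻¹0≡c))

≅-of-join-over-pair : ∀ {n} (G H : Graph (suc (suc n))) {a b} → a ≢ b →
  IsIndependentJoin G (λ x → eqb x a ∨ eqb x b) → IsIndependentJoin H inA →
  Adj G a b ≡ Adj H 0F 1F → G ≅ H
≅-of-join-over-pair G H {a} {b} a≢b JG JH Gab≡H01 with permutation-sending-to-01 a≢b
... | π , π⁻¹0≡a , π⁻¹1≡b =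
  ≅-of-independentJoins π JG JH inA≗ a b (λ u → eqb-∨≡true⇒≡)
    (trans Gab≡H01 (sym (cong₂ (Adj H) (πx≡ π⁻¹0≡a) (πx≡ π⁻¹1≡b))))
  where
  πx≡ : ∀ {x y} → π ⟨$⟩ˡ y ≡ x → π ⟨$⟩ʳ x ≡ y
  πx≡ refl = inverseʳ π
  inA≗ : ∀ u → inA (π ⟨$⟩ʳ u) ≡ (eqb u a ∨ eqb u b)
  inA≗ u = trans (inA≡eqb01 (π ⟨$⟩ʳ u))
    (cong₂ _∨_ (trans (eqb-⟨$⟩ʳ π u 0F) (cong (eqb u) π⁻¹0≡a))
               (trans (eqb-⟨$⟩ʳ π u 1F) (cong (eqb u) π⁻¹1≡b)))

connected-Fin2-edge : (G : Graph 2) → Connected G → Adj G 0F 1F ≡ true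
connected-Fin2-edge G connected with connected 0F 1F
... | step {w = 0F} loop _ with trans (sym loop) (Adj-irr G 0F)
...   | ()
connected-Fin2-edge G connected | step {w = 1F} edge _ = edge

≅K1n1-of-connected : (G : Graph 2) → Connected G → G ≅ K1n 1
≅K1n1-of-connected G connected = ↔⇒⤖ idₚ , adjacency
  where
  adjacency : ∀ u v → Adj G u v ≡ Adj (K1n 1) u v
  adjacency 0F 0F = Adj-irr G 0F
  adjacency 0F 1F = connected-Fin2-edge G connected
  adjacency 1F 0F = trans (Adj-sym G 1F 0F) (connected-Fin2-edge G connected)
  adjacency 1F 1F = Adj-irr G 1F

IsK1n⊎K2n⊎K*2n : ∀ {N} → Graph N → Set
IsK1n⊎K2n⊎K*2n G = ∃[ n ] (1 ≤ n × (G ≅ K1n n ⊎ G ≅ K2n n ⊎ G ≅ K*2n n))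

K1n⊎K2n⊎K*2n-of-join-over-point : ∀ {N} (G : Graph N) c → (∀ g → IsCID G g → 2 ≤ weight g) →
  IsIndependentJoin G (λ x → eqb x c) → IsK1n⊎K2n⊎K*2n G
K1n⊎K2n⊎K*2n-of-join-over-point {suc zero} G c minimal J
  with minimal (λ _ → 1) ((λ _ → s≤s z≤n) , (λ _ ()) , λ _ _ ())
... | s≤s ()
K1n⊎K2n⊎K*2n-of-join-over-point {suc (suc n)} G c minimal J =
  suc n , s≤s z≤n , inj₁ (≅K1n-of-join-over-point G c J)

K1n⊎K2n⊎K*2n-of-join-over-pair : ∀ {N} (G : Graph N) → Connected G → ∀ {a b} → a ≢ b →
  IsIndependentJoin G (λ x → eqb x a ∨ eqb x b) → IsK1n⊎K2n⊎K*2n G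
K1n⊎K2n⊎K*2n-of-join-over-pair {suc zero} G connected {0F} {0F} a≢b J = ⊥-elim (a≢b refl)
-- On two vertices the join condition says nothing about the edge ab; connectivity supplies it.
K1n⊎K2n⊎K*2n-of-join-over-pair {suc (suc zero)} G connected a≢b J =
  1 , s≤s z≤n , inj₁ (≅K1n1-of-connected G connected)
K1n⊎K2n⊎K*2n-of-join-over-pair {suc (suc (suc m))} G connected {a} {b} a≢b J with Adj G a b in ab
... | false = suc m , s≤s z≤n ,
                inj₂ (inj₁ (≅-of-join-over-pair G (K2n (suc m)) a≢b J (K2n-isIndependentJoin (suc m)) ab))
... | true  = suc m , s≤s z≤n ,
                inj₂ (inj₂ (≅-of-join-over-pair G (K*2n (suc m)) a≢b J (K*2n-isIndependentJoin (suc m)) ab))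

K1n⊎K2n⊎K*2n-of-γcI≡2 : ∀ {N} (G : Graph N) → Connected G → γcI≡ G 2 → IsK1n⊎K2n⊎K*2n G
K1n⊎K2n⊎K*2n-of-γcI≡2 {N} G connected ((f , cid , w≡2) , minimal)
  with ΣFin≡2⇒WeightTwo N f w≡2 | cid⇒independentJoin G f cid (≤-reflexive w≡2)
... | single c f≗ | J = K1n⊎K2n⊎K*2n-of-join-over-point G c minimal
        (independentJoin-resp (λ x → trans (support-cong f≗ x) (support-pointMass c 1 x)) J)
... | double a b a≢b f≗ | J = K1n⊎K2n⊎K*2n-of-join-over-pair G connected a≢b
        (independentJoin-resp (λ x → trans (support-cong f≗ x) (support-pointMass₂ a b x)) J)

γcI≡2-of-K1n⊎K2n⊎K*2n : ∀ {N} (G : Graph N) → IsK1n⊎K2n⊎K*2n G → γcI≡ G 2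
γcI≡2-of-K1n⊎K2n⊎K*2n G (suc m , _ , inj₁ G≅K1n) = γcI≡2-of-≅K1n m G G≅K1n
γcI≡2-of-K1n⊎K2n⊎K*2n G (suc m , _ , inj₂ (inj₁ G≅K2n)) =
  γcI≡2-of-≅-inA-join m G (K2n (suc m)) (K2n-isIndependentJoin (suc m)) refl G≅K2n
γcI≡2-of-K1n⊎K2n⊎K*2n G (suc m , _ , inj₂ (inj₂ G≅K*2n)) =
  γcI≡2-of-≅-inA-join m G (K*2n (suc m)) (K*2n-isIndependentJoin (suc m)) refl G≅K*2n

proposition9 : ∀ {N : ℕ} (G : Graph N) → Connected G →
    (γcI≡ G 2 ⇔ (∃[ n ] (1 ≤ n × (G ≅ K1n n ⊎ G ≅ K2n n ⊎ G ≅ K*2n n))))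
proposition9 G connected = mk⇔ (K1n⊎K2n⊎K*2n-of-γcI≡2 G connected) (γcI≡2-of-K1n⊎K2n⊎K*2n G)
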